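{- Let $a, b, n$ be nonnegative integers with $a>b\ge 1$. Then: (i) If $n\ge 2$, then $$\nu_2\big(S(a2^{n},3)-S(b2^n, 3)\big) \begin{cases} = n+1+\nu_2(a-b) & \text{if } b2^n>n+2+\nu_2(a-b),\\ > n+1+\nu_2(a-b) & \text{if } b2^n=n+2+\nu_2(a-b),\\ = b2^n-1 & \text{if } b2^n<n+2+\nu_2(a-b).\end{cases}$$ (ii) If $n\ge 3$, then $$\nu_2\big(S(a2^{n},7)-S(b2^n, 7)\big) \begin{cases} = n+1+\nu_2(a-b) & \text{if } b2^n>n+3+\nu_2(a-b),\\ > n+1+\nu_2(a-b) & \text{if } b2^n=n+3+\nu_2(a-b),\\ = b2^n-2 & \text{if } b2^n<n+3+\nu_2(a-b).\end{cases}$$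
   Context: $S(n,k)$ denotes the Stirling number of the second kind (the number of partitions of an $n$-element set into exactly $k$ nonempty blocks). For a nonzero integer $m$, $\nu_2(m)$ denotes the 2-adic valuation of $m$, i.e. the exponent of the largest power of $2$ dividing $m$. -}

module Defs where

open import Data.Nat using (ℕ; zero; suc; _+_; _*_; _^_)
open import Data.Integer using (ℤ; +_; _-_)
open import Data.Integer.Divisibility using (_∣_)
open import Data.Product using (_×_)
open import Relation.Nullary using (¬_)
open import Relation.Binary.PropositionalEquality using (_≢_)

S : ℕ → ℕ → ℕ
S zero    zero    = 1
S zero    (suc k) = 0
S (suc n) zero    = 0
S (suc n) (suc k) = suc k * S n (suc k) + S n k

Sdiff : ℕ → ℕ → ℕ → ℤ
Sdiff x y k = + S x k - + S y k

ν₂≡ : ℤ → ℕ → Set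
ν₂≡ m e = (m ≢ + 0) × (+ (2 ^ e) ∣ m) × ¬ (+ (2 ^ suc e) ∣ m)

ν₂> : ℤ → ℕ → Set
ν₂> m t = (m ≢ + 0) × (+ (2 ^ suc t) ∣ m)

ν₂≡ℕ : ℕ → ℕ → Set
ν₂≡ℕ m e = ν₂≡ (+ m) e

-- For m ≥ 1, k! S(m,k) is the k-th forward difference of i ↦ i^m at 0; hence 6 S(m,3) = 3^m - 3·2^m + 3
-- and 5040 S(m,7) = Σᵢ (-1)^(7-i) C(7,i) i^m.  Put y = b·2^n and t = (a-b)·2^n, so that ν₂(t) = n + d.
-- Then 6 (S(y+t,3) - S(y,3)) = 3^y (3^t - 1) - 2^y · 3 (2^t - 1), where the first term has valuation
-- exactly n + d + 2 (lifting the exponent) and the second exactly y.  A difference of two terms of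
-- different valuations has the smaller one, and of equal valuations a larger one; dividing by 6 = 2·3
-- gives (i).  For (ii), 5040 (S(y+t,7) - S(y,7)) is the odd-base part (7^t - 1) + 21 (5^t - 1) + 35 (3^t - 1),
-- of valuation exactly n + d + 5 (checked at t = 8, then propagated by squaring and by odd powers), plus
-- terms divisible by 2^(n+d+6), minus 2^y times a number of valuation exactly 2; dividing by
-- 5040 = 2^4 · 315 gives (ii).
module Submission where

open import Defs
open import Data.Nat as ℕ using (ℕ; zero; suc; _≤_; _<_; z≤n; s≤s)
import Data.Nat.Properties as ℕ
import Data.Nat.Divisibility as ℕ
open import Data.Nat.Tactic.RingSolver as ℕ-Solver using ()
open import Data.Product using (_×_; _,_; ∃-syntax)
open import Data.Sum using (_⊎_; inj₁; inj₂)
open import Data.Empty using (⊥-elim)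
open import Relation.Binary.PropositionalEquality

module StirlingClosedForm where

  open import Data.Nat using (_!)
  open import Data.Integer using (ℤ; +_; -_; _+_; _-_; _*_; _^_)
  open import Data.Integer.Properties using (pos-+; pos-*; ^-zeroˡ; *-zeroʳ; +-identityˡ; +-identityʳ; *-identityˡ)
  open import Data.Integer.Tactic.RingSolver using (solve-∀)
  open import Data.List using (List; []; _∷_)
  open import Function.Nary.NonDependent using (congₙ)
  open ≡-Reasoning

  Δ : (ℕ → ℤ) → ℕ → ℤ
  Δ f i = f (suc i) - f i

  Δ^ : ℕ → (ℕ → ℤ) → ℕ → ℤ
  Δ^ zero    f = f
  Δ^ (suc k) f = Δ^ k (Δ f)

  Δ^-cong : ∀ k {f g} → (∀ i → f i ≡ g i) → ∀ x → Δ^ k f x ≡ Δ^ k g x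
  Δ^-cong zero    f≗g = f≗g
  Δ^-cong (suc k) f≗g = Δ^-cong k (λ i → cong₂ _-_ (f≗g (suc i)) (f≗g i))

  Δ^-+ : ∀ k f g x → Δ^ k (λ i → f i + g i) x ≡ Δ^ k f x + Δ^ k g x
  Δ^-+ zero    f g x = refl
  Δ^-+ (suc k) f g x = trans (Δ^-cong k (λ i → swap (f (suc i)) (g (suc i)) (f i) (g i)) x) (Δ^-+ k (Δ f) (Δ g) x)
    where
    swap : ∀ a b c d → (a + b) - (c + d) ≡ (a - c) + (b - d)
    swap = solve-∀

  Δ^-− : ∀ k f g x → Δ^ k (λ i → f i - g i) x ≡ Δ^ k f x - Δ^ k g x
  Δ^-− zero    f g x = refl
  Δ^-− (suc k) f g x = trans (Δ^-cong k (λ i → swap (f (suc i)) (g (suc i)) (f i) (g i)) x) (Δ^-− k (Δ f) (Δ g) x)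
    where
    swap : ∀ a b c d → (a - b) - (c - d) ≡ (a - c) - (b - d)
    swap = solve-∀

  Δ^-shift : ∀ k f x → Δ^ k (λ i → f (suc i)) x ≡ Δ^ k f (suc x)
  Δ^-shift zero    f x = refl
  Δ^-shift (suc k) f x = Δ^-shift k (Δ f) x

  Δ^-suc : ∀ k f x → Δ^ (suc k) f x ≡ Δ^ k f (suc x) - Δ^ k f x
  Δ^-suc k f x = trans (Δ^-− k (λ i → f (suc i)) f x) (cong (_- Δ^ k f x) (Δ^-shift k f x))

  Δ^-zero : ∀ k x → Δ^ k (λ _ → + 0) x ≡ + 0
  Δ^-zero zero    x = refl
  Δ^-zero (suc k) x = Δ^-zero k x

  Δ^-leibniz : ∀ k f x →
    Δ^ (suc k) (λ i → + i * f i) x ≡ + x * Δ^ (suc k) f x + + suc k * Δ^ k f (suc x)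
  Δ^-leibniz zero f x = step (+ x) (f x) (f (suc x))
    where
    step : ∀ x a b → (+ 1 + x) * b - x * a ≡ x * (b - a) + + 1 * b
    step = solve-∀
  Δ^-leibniz (suc k) f x = begin
    Δ^ (suc k) (Δ (λ i → + i * f i)) x
      ≡⟨ Δ^-cong (suc k) (λ i → product-rule (+ i) (f i) (f (suc i))) x ⟩
    Δ^ (suc k) (λ i → + i * Δ f i + f (suc i)) x
      ≡⟨ Δ^-+ (suc k) (λ i → + i * Δ f i) (λ i → f (suc i)) x ⟩
    Δ^ (suc k) (λ i → + i * Δ f i) x + Δ^ (suc k) (λ i → f (suc i)) x
      ≡⟨ cong₂ _+_ (Δ^-leibniz k (Δ f) x) (Δ^-shift (suc k) f x) ⟩
    + x * Δ^ (suc (suc k)) f x + + suc k * Δ^ (suc k) f (suc x) + Δ^ (suc k) f (suc x)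
      ≡⟨ collect (+ x * Δ^ (suc (suc k)) f x) (+ suc k) (Δ^ (suc k) f (suc x)) ⟩
    + x * Δ^ (suc (suc k)) f x + (+ 1 + + suc k) * Δ^ (suc k) f (suc x) ∎
    where
    product-rule : ∀ x a b → (+ 1 + x) * b - x * a ≡ x * (b - a) + b
    product-rule = solve-∀
    collect : ∀ a k d → a + k * d + d ≡ a + (+ 1 + k) * d
    collect = solve-∀

  pos-S-suc : ∀ m k → + S (suc m) (suc k) ≡ + suc k * + S m (suc k) + + S m k
  pos-S-suc m k = trans (pos-+ (suc k ℕ.* S m (suc k)) (S m k)) (cong (_+ + S m k) (pos-* (suc k) (S m (suc k))))

  factorial-stirling : ∀ m k → + (k !) * + S m k ≡ Δ^ k (λ i → (+ i) ^ m) 0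
  factorial-stirling zero    zero    = refl
  factorial-stirling zero    (suc k) = trans (*-zeroʳ (+ (suc k !))) (sym (Δ^-zero k 0))
  factorial-stirling (suc m) zero    = refl
  factorial-stirling (suc m) (suc k) = begin
    + (suc k !) * + S (suc m) (suc k)
      ≡⟨ cong₂ _*_ (pos-* (suc k) (k !)) (pos-S-suc m k) ⟩
    + suc k * + (k !) * (+ suc k * + S m (suc k) + + S m k)
      ≡⟨ regroup (+ suc k) (+ (k !)) (+ S m (suc k)) (+ S m k) ⟩
    + suc k * (+ (k !) * + S m k + + suc k * + (k !) * + S m (suc k))
      ≡⟨ cong (λ z → + suc k * (+ (k !) * + S m k + z * + S m (suc k))) (pos-* (suc k) (k !)) ⟨
    + suc k * (+ (k !) * + S m k + + (suc k !) * + S m (suc k))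
      ≡⟨ cong (λ z → + suc k * z) (cong₂ _+_ (factorial-stirling m k) (factorial-stirling m (suc k))) ⟩
    + suc k * (Δ^ k p 0 + Δ^ (suc k) p 0)
      ≡⟨ cong (+ suc k *_) (trans (cong (λ z → Δ^ k p 0 + z) (Δ^-suc k p 0)) (cancel (Δ^ k p 0) (Δ^ k p 1))) ⟩
    + suc k * Δ^ k p 1
      ≡⟨ trans (Δ^-leibniz k p 0) (+-identityˡ _) ⟨
    Δ^ (suc k) (λ i → (+ i) ^ suc m) 0 ∎
    where
    p : ℕ → ℤ
    p i = (+ i) ^ m
    regroup : ∀ k f s s' → k * f * (k * s + s') ≡ k * (f * s' + k * f * s)
    regroup = solve-∀
    cancel : ∀ a b → a + (b - a) ≡ b
    cancel = solve-∀

  Σshift : List ℤ → (ℕ → ℤ) → ℕ → ℤ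
  Σshift []       f x = + 0
  Σshift (c ∷ cs) f x = c * f x + Σshift cs f (suc x)

  -- Multiplication of a coefficient list by X - 1, where c is the coefficient carried in from the degree below.
  X-1* : ℤ → List ℤ → List ℤ
  X-1* c []       = c ∷ []
  X-1* c (d ∷ ds) = (c - d) ∷ X-1* d ds

  Δ-coefficients : ℕ → List ℤ
  Δ-coefficients zero    = + 1 ∷ []
  Δ-coefficients (suc k) = X-1* (+ 0) (Δ-coefficients k)

  Σshift-X-1* : ∀ c ds f x → Σshift (X-1* c ds) f x ≡ c * f x + Σshift ds (Δ f) x
  Σshift-X-1* c []       f x = refl
  Σshift-X-1* c (d ∷ ds) f x = begin
    (c - d) * f x + Σshift (X-1* d ds) f (suc x)
      ≡⟨ cong (λ r → (c - d) * f x + r) (Σshift-X-1* d ds f (suc x)) ⟩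
    (c - d) * f x + (d * f (suc x) + Σshift ds (Δ f) (suc x))
      ≡⟨ regroup c d (f x) (f (suc x)) (Σshift ds (Δ f) (suc x)) ⟩
    c * f x + (d * (f (suc x) - f x) + Σshift ds (Δ f) (suc x)) ∎
    where
    regroup : ∀ c d a b r → (c - d) * a + (d * b + r) ≡ c * a + (d * (b - a) + r)
    regroup = solve-∀

  Δ^-binomial : ∀ k f x → Δ^ k f x ≡ Σshift (Δ-coefficients k) f x
  Δ^-binomial zero    f x = sym (trans (+-identityʳ _) (*-identityˡ (f x)))
  Δ^-binomial (suc k) f x =
    trans (Δ^-binomial k (Δ f) x) (sym (trans (Σshift-X-1* (+ 0) (Δ-coefficients k) f x) (+-identityˡ _)))

  -- The left-hand side of each expand is what Σshift (Δ-coefficients k) f 0 computes to.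
  Δ^3-at-0 : ∀ f → Δ^ 3 f 0 ≡ f 3 - + 3 * f 2 + + 3 * f 1 - f 0
  Δ^3-at-0 f = trans (Δ^-binomial 3 f 0) (expand (f 0) (f 1) (f 2) (f 3))
    where
    expand : ∀ a₀ a₁ a₂ a₃ →
      - + 1 * a₀ + (+ 3 * a₁ + (- + 3 * a₂ + (+ 1 * a₃ + + 0))) ≡ a₃ - + 3 * a₂ + + 3 * a₁ - a₀
    expand = solve-∀

  Δ^7-at-0 : ∀ f → Δ^ 7 f 0 ≡
    f 7 - + 7 * f 6 + + 21 * f 5 - + 35 * f 4 + + 35 * f 3 - + 21 * f 2 + + 7 * f 1 - f 0
  Δ^7-at-0 f = trans (Δ^-binomial 7 f 0) (expand (f 0) (f 1) (f 2) (f 3) (f 4) (f 5) (f 6) (f 7))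
    where
    expand : ∀ a₀ a₁ a₂ a₃ a₄ a₅ a₆ a₇ →
      - + 1 * a₀ + (+ 7 * a₁ + (- + 21 * a₂ + (+ 35 * a₃
        + (- + 35 * a₄ + (+ 21 * a₅ + (- + 7 * a₆ + (+ 1 * a₇ + + 0)))))))
        ≡ a₇ - + 7 * a₆ + + 21 * a₅ - + 35 * a₄ + + 35 * a₃ - + 21 * a₂ + + 7 * a₁ - a₀
    expand = solve-∀

  -- Stated for m + 1 because then the base-0 term 0^(m+1) of the expansion computes to 0.
  stirling-3 : ∀ m → + 6 * + S (suc m) 3 ≡ (+ 3) ^ suc m - + 3 * (+ 2) ^ suc m + + 3
  stirling-3 m = begin
    + 6 * + S (suc m) 3                 ≡⟨ factorial-stirling (suc m) 3 ⟩
    Δ^ 3 p 0                            ≡⟨ Δ^3-at-0 p ⟩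
    p 3 - + 3 * p 2 + + 3 * p 1 - + 0   ≡⟨ cong (λ u → p 3 - + 3 * p 2 + + 3 * u - + 0) (^-zeroˡ (suc m)) ⟩
    p 3 - + 3 * p 2 + + 3 * + 1 - + 0   ≡⟨ tidy (p 3) (p 2) ⟩
    p 3 - + 3 * p 2 + + 3               ∎
    where
    p : ℕ → ℤ
    p c = (+ c) ^ suc m
    tidy : ∀ a b → a - + 3 * b + + 3 * + 1 - + 0 ≡ a - + 3 * b + + 3
    tidy = solve-∀

  ^-distribʳ-* : ∀ i j m → (i * j) ^ m ≡ i ^ m * j ^ m
  ^-distribʳ-* i j zero    = refl
  ^-distribʳ-* i j (suc m) = trans (cong (i * j *_) (^-distribʳ-* i j m)) (interchange i j (i ^ m) (j ^ m))
    where
    interchange : ∀ i j a b → i * j * (a * b) ≡ i * a * (j * b)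
    interchange = solve-∀

  F₇ : ℤ → ℤ → ℤ → ℤ → ℤ
  F₇ a b c d = d - + 7 * (a * b) + + 21 * c - + 35 * (a * a) + + 35 * b - + 21 * a + + 7

  stirling-7 : ∀ m → + 5040 * + S (suc m) 7 ≡ F₇ ((+ 2) ^ suc m) ((+ 3) ^ suc m) ((+ 5) ^ suc m) ((+ 7) ^ suc m)
  stirling-7 m = begin
    + 5040 * + S (suc m) 7          ≡⟨ factorial-stirling (suc m) 7 ⟩
    Δ^ 7 p 0                         ≡⟨ Δ^7-at-0 p ⟩
    p 7 - + 7 * p 6 + + 21 * p 5 - + 35 * p 4 + + 35 * p 3 - + 21 * p 2 + + 7 * p 1 - + 0
      ≡⟨ congₙ 3 (λ u v w → p 7 - + 7 * u + + 21 * p 5 - + 35 * v + + 35 * p 3 - + 21 * p 2 + + 7 * w - + 0)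
               (^-distribʳ-* (+ 2) (+ 3) (suc m)) (^-distribʳ-* (+ 2) (+ 2) (suc m)) (^-zeroˡ (suc m)) ⟩
    p 7 - + 7 * (p 2 * p 3) + + 21 * p 5 - + 35 * (p 2 * p 2) + + 35 * p 3 - + 21 * p 2 + + 7 * + 1 - + 0
      ≡⟨ tidy (p 2) (p 3) (p 5) (p 7) ⟩
    F₇ (p 2) (p 3) (p 5) (p 7) ∎
    where
    p : ℕ → ℤ
    p c = (+ c) ^ suc m
    tidy : ∀ a b c d → d - + 7 * (a * b) + + 21 * c - + 35 * (a * a) + + 35 * b - + 21 * a + + 7 * + 1 - + 0
                     ≡ d - + 7 * (a * b) + + 21 * c - + 35 * (a * a) + + 35 * b - + 21 * a + + 7
    tidy = solve-∀

module TwoAdicValuation where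

  open import Data.Integer using (ℤ; +_; -_; _+_; _-_; _*_; _^_; _/_; _%_; ≢-nonZero)
  open import Data.Integer.Properties
    using ( pos-*; ^-distribˡ-+-*; i^n≡0⇒i≡0; *-cancelˡ-≡; i*j≡0⇒i≡0∨j≡0
          ; *-comm; *-assoc; *-identityˡ; *-identityʳ; *-distribʳ-+)
  import Data.Integer.Divisibility as Unsigned
  open import Data.Integer.Divisibility.Signed
  open import Data.Integer.DivMod using (a≡a%n+[a/n]*n; n%d<d)
  open import Data.Integer.Tactic.RingSolver using (solve-∀)
  open import Relation.Nullary using (¬_)
  open ≡-Reasoning

  infix 4 2^_∣_ 2^_∥_

  -- Records rather than (+ 2) ^ e ∣ x, so that the exponent e can be inferred from a type.
  record 2^_∣_ (e : ℕ) (x : ℤ) : Set where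
    constructor multiple
    field
      quotient : ℤ
      equality : x ≡ quotient * (+ 2) ^ e

  record 2^_∥_ (e : ℕ) (x : ℤ) : Set where
    constructor exactly
    field
      k        : ℤ
      equality : x ≡ (+ 2) ^ e * (+ 1 + + 2 * k)

  pow2≢0 : ∀ e → (+ 2) ^ e ≢ + 0
  pow2≢0 e eq with i^n≡0⇒i≡0 (+ 2) e eq
  ... | ()

  odd≢even : ∀ k j → + 1 + + 2 * k ≢ + 2 * j
  odd≢even k j eq with ℕ.∣1⇒≡1 (∣⇒∣ᵤ (divides (j - k) (rearrange k j eq)))
    where
    rearrange : ∀ k j → + 1 + + 2 * k ≡ + 2 * j → + 1 ≡ (j - k) * + 2
    rearrange k j eq = trans (isolate k) (trans (cong (_- + 2 * k) eq) (factor j k))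
      where
      isolate : ∀ k → + 1 ≡ (+ 1 + + 2 * k) - + 2 * k
      isolate = solve-∀
      factor : ∀ j k → + 2 * j - + 2 * k ≡ (j - k) * + 2
      factor = solve-∀
  ... | ()

  parity : ∀ x → (∃[ j ] x ≡ + 2 * j) ⊎ 2^ 0 ∥ x
  parity x with x % + 2 | n%d<d x (+ 2) | a≡a%n+[a/n]*n x (+ 2)
  ... | 0           | _             | eq = inj₁ (x / + 2 , trans eq (even (x / + 2)))
    where
    even : ∀ q → + 0 + q * + 2 ≡ + 2 * q
    even = solve-∀
  ... | 1           | _             | eq = inj₂ (exactly (x / + 2) (trans eq (odd (x / + 2))))
    where
    odd : ∀ q → + 1 + q * + 2 ≡ + 1 * (+ 1 + + 2 * q)
    odd = solve-∀
  ... | suc (suc _) | s≤s (s≤s ()) | _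

  ∣-weaken : ∀ {e f x} → f ≤ e → 2^ e ∣ x → 2^ f ∣ x
  ∣-weaken {e} {f} f≤e (multiple q refl) = multiple (q * (+ 2) ^ (e ℕ.∸ f)) (begin
    q * (+ 2) ^ e                         ≡⟨ cong (λ m → q * (+ 2) ^ m) (ℕ.m∸n+n≡m f≤e) ⟨
    q * (+ 2) ^ (e ℕ.∸ f ℕ.+ f)           ≡⟨ cong (q *_) (^-distribˡ-+-* (+ 2) (e ℕ.∸ f) f) ⟩
    q * ((+ 2) ^ (e ℕ.∸ f) * (+ 2) ^ f)   ≡⟨ *-assoc q _ _ ⟨
    q * (+ 2) ^ (e ℕ.∸ f) * (+ 2) ^ f     ∎)

  ∣-+ : ∀ {e x y} → 2^ e ∣ x → 2^ e ∣ y → 2^ e ∣ x + y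
  ∣-+ {e} (multiple q refl) (multiple r refl) = multiple (q + r) (sym (*-distribʳ-+ ((+ 2) ^ e) q r))

  ∣-scale : ∀ {e x} c → 2^ e ∣ x → 2^ e ∣ c * x
  ∣-scale {e} c (multiple q refl) = multiple (c * q) (sym (*-assoc c q ((+ 2) ^ e)))

  ∣-* : ∀ {e f x y} → 2^ e ∣ x → 2^ f ∣ y → 2^ (e ℕ.+ f) ∣ x * y
  ∣-* {e} {f} (multiple q refl) (multiple r refl) = multiple (q * r) (begin
    q * (+ 2) ^ e * (r * (+ 2) ^ f)   ≡⟨ interchange q r ((+ 2) ^ e) ((+ 2) ^ f) ⟩
    q * r * ((+ 2) ^ e * (+ 2) ^ f)   ≡⟨ cong (q * r *_) (^-distribˡ-+-* (+ 2) e f) ⟨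
    q * r * (+ 2) ^ (e ℕ.+ f)         ∎)
    where
    interchange : ∀ q r a b → q * a * (r * b) ≡ q * r * (a * b)
    interchange = solve-∀

  ∥-pow2 : ∀ e → 2^ e ∥ (+ 2) ^ e
  ∥-pow2 e = exactly (+ 0) (times-one ((+ 2) ^ e))
    where
    times-one : ∀ a → a ≡ a * (+ 1 + + 2 * + 0)
    times-one = solve-∀

  ∥⇒∣ : ∀ {e x} → 2^ e ∥ x → 2^ e ∣ x
  ∥⇒∣ {e} (exactly k refl) = multiple (+ 1 + + 2 * k) (*-comm ((+ 2) ^ e) _)

  ∥⇒≢0 : ∀ {e x} → 2^ e ∥ x → x ≢ + 0
  ∥⇒≢0 {e} (exactly k refl) eq with i*j≡0⇒i≡0∨j≡0 ((+ 2) ^ e) eq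
  ... | inj₁ 2^e≡0 = pow2≢0 e 2^e≡0
  ... | inj₂ odd≡0 = odd≢even k (+ 0) odd≡0

  ∥-+-∣ : ∀ {e x y} → 2^ e ∥ x → 2^ suc e ∣ y → 2^ e ∥ x + y
  ∥-+-∣ {e} (exactly k refl) (multiple q refl) = exactly (k + q) (absorb k q ((+ 2) ^ e))
    where
    absorb : ∀ k q p → p * (+ 1 + + 2 * k) + q * (+ 2 * p) ≡ p * (+ 1 + + 2 * (k + q))
    absorb = solve-∀

  ∥-−-∣ : ∀ {e x y} → 2^ e ∥ x → 2^ suc e ∣ y → 2^ e ∥ x - y
  ∥-−-∣ {e} (exactly k refl) (multiple q refl) = exactly (k - q) (absorb k q ((+ 2) ^ e))
    where
    absorb : ∀ k q p → p * (+ 1 + + 2 * k) - q * (+ 2 * p) ≡ p * (+ 1 + + 2 * (k - q))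
    absorb = solve-∀

  ∣-−-∥ : ∀ {e x y} → 2^ suc e ∣ x → 2^ e ∥ y → 2^ e ∥ x - y
  ∣-−-∥ {e} (multiple q refl) (exactly k refl) = exactly (q - k - + 1) (absorb k q ((+ 2) ^ e))
    where
    absorb : ∀ k q p → q * (+ 2 * p) - p * (+ 1 + + 2 * k) ≡ p * (+ 1 + + 2 * (q - k - + 1))
    absorb = solve-∀

  ∥-−-∥ : ∀ {e x y} → 2^ e ∥ x → 2^ e ∥ y → 2^ suc e ∣ x - y
  ∥-−-∥ {e} (exactly k refl) (exactly l refl) = multiple (k - l) (cancel k l ((+ 2) ^ e))
    where
    cancel : ∀ k l p → p * (+ 1 + + 2 * k) - p * (+ 1 + + 2 * l) ≡ (k - l) * (+ 2 * p)
    cancel = solve-∀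

  ∥-* : ∀ {e f x y} → 2^ e ∥ x → 2^ f ∥ y → 2^ (e ℕ.+ f) ∥ x * y
  ∥-* {e} {f} (exactly k refl) (exactly l refl) = exactly (k + l + + 2 * k * l) (begin
    (+ 2) ^ e * (+ 1 + + 2 * k) * ((+ 2) ^ f * (+ 1 + + 2 * l))
      ≡⟨ interchange k l ((+ 2) ^ e) ((+ 2) ^ f) ⟩
    (+ 2) ^ e * (+ 2) ^ f * (+ 1 + + 2 * (k + l + + 2 * k * l))
      ≡⟨ cong (_* _) (^-distribˡ-+-* (+ 2) e f) ⟨
    (+ 2) ^ (e ℕ.+ f) * (+ 1 + + 2 * (k + l + + 2 * k * l)) ∎)
    where
    interchange : ∀ k l p r → p * (+ 1 + + 2 * k) * (r * (+ 1 + + 2 * l)) ≡ p * r * (+ 1 + + 2 * (k + l + + 2 * k * l))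
    interchange = solve-∀

  ∣-cancel-odd : ∀ {c e y} → 2^ 0 ∥ c → 2^ e ∣ c * y → 2^ e ∣ y
  ∣-cancel-odd {e = zero}  {y} _ _ = multiple y (sym (*-identityʳ y))
  ∣-cancel-odd {c} {suc e} {y} c-odd@(exactly k refl) (multiple r cy≡)
    with ∣-cancel-odd c-odd (∣-weaken (ℕ.n≤1+n e) (multiple r cy≡))
  ... | multiple q refl with parity q
  ...   | inj₁ (j , refl) = multiple j (shift j ((+ 2) ^ e))
    where
    shift : ∀ j p → + 2 * j * p ≡ j * (+ 2 * p)
    shift = solve-∀
  ...   | inj₂ (exactly j refl) = ⊥-elim (odd≢even (k + j + + 2 * k * j) r
    (*-cancelˡ-≡ ((+ 2) ^ e) _ _ {{≢-nonZero (pow2≢0 e)}} (begin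
      (+ 2) ^ e * (+ 1 + + 2 * (k + j + + 2 * k * j))       ≡⟨ regroup k j ((+ 2) ^ e) ⟩
      (+ 1 * (+ 1 + + 2 * k)) * ((+ 1 * (+ 1 + + 2 * j)) * (+ 2) ^ e) ≡⟨ cy≡ ⟩
      r * (+ 2 * (+ 2) ^ e)                                 ≡⟨ regroup′ r ((+ 2) ^ e) ⟩
      (+ 2) ^ e * (+ 2 * r) ∎)))
    where
    regroup : ∀ k j p → p * (+ 1 + + 2 * (k + j + + 2 * k * j)) ≡ (+ 1 * (+ 1 + + 2 * k)) * ((+ 1 * (+ 1 + + 2 * j)) * p)
    regroup = solve-∀
    regroup′ : ∀ r p → r * (+ 2 * p) ≡ p * (+ 2 * r)
    regroup′ = solve-∀

  ∥-cancel-odd : ∀ {c e y} → 2^ 0 ∥ c → 2^ e ∥ c * y → 2^ e ∥ y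
  ∥-cancel-odd {c} {e} c-odd cy∥@(exactly m cy≡) with ∣-cancel-odd c-odd (∥⇒∣ cy∥)
  ... | multiple q refl with parity q | c-odd
  ...   | inj₂ (exactly j refl) | _ = exactly j (regroup j ((+ 2) ^ e))
    where
    regroup : ∀ j p → + 1 * (+ 1 + + 2 * j) * p ≡ p * (+ 1 + + 2 * j)
    regroup = solve-∀
  ...   | inj₁ (j , refl) | exactly k refl = ⊥-elim (odd≢even m (+ 1 * (+ 1 + + 2 * k) * j)
    (sym (*-cancelˡ-≡ ((+ 2) ^ e) _ _ {{≢-nonZero (pow2≢0 e)}} (trans (regroup (+ 1 * (+ 1 + + 2 * k)) j ((+ 2) ^ e)) cy≡))))
    where
    regroup : ∀ c j p → p * (+ 2 * (c * j)) ≡ c * (+ 2 * j * p)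
    regroup = solve-∀

  ∣-cancel-pow2 : ∀ {k e x} → 2^ (k ℕ.+ e) ∣ (+ 2) ^ k * x → 2^ e ∣ x
  ∣-cancel-pow2 {k} {e} {x} (multiple q eq) = multiple q (*-cancelˡ-≡ ((+ 2) ^ k) _ _ {{≢-nonZero (pow2≢0 k)}} (begin
    (+ 2) ^ k * x                     ≡⟨ eq ⟩
    q * (+ 2) ^ (k ℕ.+ e)             ≡⟨ cong (q *_) (^-distribˡ-+-* (+ 2) k e) ⟩
    q * ((+ 2) ^ k * (+ 2) ^ e)       ≡⟨ regroup q ((+ 2) ^ k) ((+ 2) ^ e) ⟩
    (+ 2) ^ k * (q * (+ 2) ^ e)       ∎))
    where
    regroup : ∀ q a b → q * (a * b) ≡ a * (q * b)
    regroup = solve-∀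

  ∥-cancel-pow2 : ∀ {k e x} → 2^ (k ℕ.+ e) ∥ (+ 2) ^ k * x → 2^ e ∥ x
  ∥-cancel-pow2 {k} {e} {x} (exactly m eq) = exactly m (*-cancelˡ-≡ ((+ 2) ^ k) _ _ {{≢-nonZero (pow2≢0 k)}} (begin
    (+ 2) ^ k * x                                 ≡⟨ eq ⟩
    (+ 2) ^ (k ℕ.+ e) * (+ 1 + + 2 * m)           ≡⟨ cong (_* _) (^-distribˡ-+-* (+ 2) k e) ⟩
    (+ 2) ^ k * (+ 2) ^ e * (+ 1 + + 2 * m)       ≡⟨ *-assoc ((+ 2) ^ k) _ _ ⟩
    (+ 2) ^ k * ((+ 2) ^ e * (+ 1 + + 2 * m))     ∎))

  pos-2^ : ∀ e → + (2 ℕ.^ e) ≡ (+ 2) ^ e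
  pos-2^ zero    = refl
  pos-2^ (suc e) = trans (pos-* 2 (2 ℕ.^ e)) (cong (+ 2 *_) (pos-2^ e))

  ∣⇒unsigned : ∀ {e x} → 2^ e ∣ x → + (2 ℕ.^ e) Unsigned.∣ x
  ∣⇒unsigned {e} (multiple q eq) = ∣⇒∣ᵤ (divides q (trans eq (cong (q *_) (sym (pos-2^ e)))))

  ∥⇒ν₂≡ : ∀ {e x} → 2^ e ∥ x → ν₂≡ x e
  ∥⇒ν₂≡ {e} x∥@(exactly k refl) = ∥⇒≢0 x∥ , ∣⇒unsigned (∥⇒∣ x∥) , λ h → not-higher (∣ᵤ⇒∣ h)
    where
    not-higher : ¬ (+ (2 ℕ.^ suc e) ∣ (+ 2) ^ e * (+ 1 + + 2 * k))
    not-higher (divides q eq) = odd≢even k q (*-cancelˡ-≡ ((+ 2) ^ e) _ _ {{≢-nonZero (pow2≢0 e)}}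
      (trans eq (trans (cong (q *_) (pos-2^ (suc e))) (regroup q ((+ 2) ^ e)))))
      where
      regroup : ∀ q p → q * (+ 2 * p) ≡ p * (+ 2 * q)
      regroup = solve-∀

  ∣⇒ν₂> : ∀ {e x} → x ≢ + 0 → 2^ suc e ∣ x → ν₂> x e
  ∣⇒ν₂> x≢0 h = x≢0 , ∣⇒unsigned h

  MinValuation : ℤ → ℕ → ℕ → Set
  MinValuation Δ e f = (e < f → ν₂≡ Δ e) × (e ≡ f → ν₂> Δ e) × (f < e → ν₂≡ Δ f)

  ν₂-of-difference : ∀ {k c Δ A B} e f → 2^ 0 ∥ + c → + (2 ℕ.^ k ℕ.* c) * Δ ≡ A - B → Δ ≢ + 0 →
    2^ (k ℕ.+ e) ∥ A → 2^ (k ℕ.+ f) ∥ B → MinValuation Δ e f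
  ν₂-of-difference {k} {c} {Δ} {A} {B} e f c-odd eq Δ≢0 A∥ B∥ = case-< , case-≡ , case->
    where
    factored : (+ 2) ^ k * (+ c * Δ) ≡ A - B
    factored = begin
      (+ 2) ^ k * (+ c * Δ)        ≡⟨ *-assoc ((+ 2) ^ k) (+ c) Δ ⟨
      (+ 2) ^ k * + c * Δ          ≡⟨ cong (λ z → z * + c * Δ) (pos-2^ k) ⟨
      + (2 ℕ.^ k) * + c * Δ        ≡⟨ cong (_* Δ) (pos-* (2 ℕ.^ k) c) ⟨
      + (2 ℕ.^ k ℕ.* c) * Δ        ≡⟨ eq ⟩
      A - B                        ∎
    case-< : e < f → ν₂≡ Δ e
    case-< e<f = ∥⇒ν₂≡ (∥-cancel-odd c-odd (∥-cancel-pow2 {k}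
      (subst (2^ (k ℕ.+ e) ∥_) (sym factored) (∥-−-∣ A∥ (∣-weaken (ℕ.+-monoʳ-< k e<f) (∥⇒∣ B∥))))))
    case-≡ : e ≡ f → ν₂> Δ e
    case-≡ refl = ∣⇒ν₂> Δ≢0 (∣-cancel-odd c-odd (∣-cancel-pow2 {k}
      (subst₂ 2^_∣_ (sym (ℕ.+-suc k e)) (sym factored) (∥-−-∥ A∥ B∥))))
    case-> : f < e → ν₂≡ Δ f
    case-> f<e = ∥⇒ν₂≡ (∥-cancel-odd c-odd (∥-cancel-pow2 {k}
      (subst (2^ (k ℕ.+ f) ∥_) (sym factored) (∣-−-∥ (∣-weaken (ℕ.+-monoʳ-< k f<e) (∥⇒∣ A∥)) B∥))))

module LiftingTheExponent where

  open TwoAdicValuation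
  open import Data.Integer using (ℤ; +_; -_; _+_; _-_; _*_; _^_)
  open import Data.Integer.Properties using (pos-+; pos-*; ^-distribˡ-+-*; ^-*-assoc; ^-identityʳ; *-identityˡ)
  open import Data.Integer.Tactic.RingSolver using (solve-∀)
  open ≡-Reasoning

  pow-pred-expansion : ∀ x w → ∃[ R ] x ^ w - + 1 ≡ + w * (x - + 1) + R * (x - + 1) * (x - + 1)
  pow-pred-expansion x zero    = + 0 , vanish x
    where
    vanish : ∀ x → + 1 - + 1 ≡ + 0 * (x - + 1) + + 0 * (x - + 1) * (x - + 1)
    vanish = solve-∀
  pow-pred-expansion x (suc w) with pow-pred-expansion x w
  ... | R , eq = R + + w + (x - + 1) * R , (begin
    x * x ^ w - + 1                                   ≡⟨ peel x (x ^ w) ⟩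
    x * (x ^ w - + 1) + (x - + 1)                     ≡⟨ cong (λ z → x * z + (x - + 1)) eq ⟩
    x * (+ w * (x - + 1) + R * (x - + 1) * (x - + 1)) + (x - + 1)
      ≡⟨ collect x (+ w) R ⟩
    (+ 1 + + w) * (x - + 1) + (R + + w + (x - + 1) * R) * (x - + 1) * (x - + 1) ∎)
    where
    peel : ∀ x y → x * y - + 1 ≡ x * (y - + 1) + (x - + 1)
    peel = solve-∀
    collect : ∀ x w R → x * (w * (x - + 1) + R * (x - + 1) * (x - + 1)) + (x - + 1)
                      ≡ (+ 1 + w) * (x - + 1) + (R + w + (x - + 1) * R) * (x - + 1) * (x - + 1)
    collect = solve-∀

  ∣-pow-pred : ∀ {e} x w → 2^ e ∣ x - + 1 → 2^ e ∣ x ^ w - + 1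
  ∣-pow-pred {e} x w p∣ with pow-pred-expansion x w
  ... | R , eq = subst (2^ e ∣_) (sym eq) (∣-+ (∣-scale (+ w) p∣) (∣-scale (R * (x - + 1)) p∣))

  1+2j-odd : ∀ j → 2^ 0 ∥ + (1 ℕ.+ 2 ℕ.* j)
  1+2j-odd j = exactly (+ j) (trans (trans (pos-+ 1 (2 ℕ.* j)) (cong (λ z → + 1 + z) (pos-* 2 j))) (sym (*-identityˡ _)))

  1+n≤n+n : ∀ {n} → 1 ≤ n → suc n ≤ n ℕ.+ n
  1+n≤n+n {n} 1≤n = subst (_≤ n ℕ.+ n) (ℕ.+-comm n 1) (ℕ.+-monoʳ-≤ n 1≤n)

  ∥-pow-odd-pred : ∀ {e} x j → 1 ≤ e → 2^ e ∥ x - + 1 → 2^ e ∥ x ^ (1 ℕ.+ 2 ℕ.* j) - + 1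
  ∥-pow-odd-pred {e} x j 1≤e p∥ with pow-pred-expansion x (1 ℕ.+ 2 ℕ.* j)
  ... | R , eq = subst (2^ e ∥_) (sym eq)
    (∥-+-∣ (∥-* (1+2j-odd j) p∥) (∣-weaken (1+n≤n+n 1≤e) (∣-* (∣-scale R (∥⇒∣ p∥)) (∥⇒∣ p∥))))

  ∥-square-pred : ∀ {e} x → 2 ≤ e → 2^ e ∥ x - + 1 → 2^ suc e ∥ x * x - + 1
  ∥-square-pred {e} x 2≤e p∥ = subst₂ 2^_∥_ (ℕ.+-comm e 1) (sym (factor x))
    (∥-* p∥ (∥-+-∣ (∥-pow2 1) (∣-weaken 2≤e (∥⇒∣ p∥))))
    where
    factor : ∀ x → x * x - + 1 ≡ (x - + 1) * (+ 2 + (x - + 1))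
    factor = solve-∀

  ∣-square-pred : ∀ {e} x → 1 ≤ e → 2^ e ∣ x - + 1 → 2^ suc e ∣ x * x - + 1
  ∣-square-pred {e} x 1≤e p∣ = subst₂ 2^_∣_ (ℕ.+-comm e 1) (sym (factor x))
    (∣-* p∣ (∣-+ (∥⇒∣ (∥-pow2 1)) (∣-weaken 1≤e p∣)))
    where
    factor : ∀ x → x * x - + 1 ≡ (x - + 1) * (+ 2 + (x - + 1))
    factor = solve-∀

  ^-2^-suc : ∀ x s → x ^ (2 ℕ.^ suc s) ≡ x ^ (2 ℕ.^ s) * x ^ (2 ℕ.^ s)
  ^-2^-suc x s = trans (^-distribˡ-+-* x (2 ℕ.^ s) (2 ℕ.^ s ℕ.+ 0))
                       (cong (λ m → x ^ (2 ℕ.^ s) * x ^ m) (ℕ.+-identityʳ (2 ℕ.^ s)))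

  ∥-pow-2^-pred : ∀ {e} x s → 2 ≤ e → 2^ e ∥ x - + 1 → 2^ (s ℕ.+ e) ∥ x ^ (2 ℕ.^ s) - + 1
  ∥-pow-2^-pred x zero    _   p∥ = subst (λ y → 2^ _ ∥ y - + 1) (sym (^-identityʳ x)) p∥
  ∥-pow-2^-pred {e} x (suc s) 2≤e p∥ = subst (λ y → 2^ _ ∥ y - + 1) (sym (^-2^-suc x s))
    (∥-square-pred (x ^ (2 ℕ.^ s)) (ℕ.≤-trans 2≤e (ℕ.m≤n+m e s)) (∥-pow-2^-pred x s 2≤e p∥))

  ∣-pow-2^-pred : ∀ {e} x s → 1 ≤ e → 2^ e ∣ x - + 1 → 2^ (s ℕ.+ e) ∣ x ^ (2 ℕ.^ s) - + 1
  ∣-pow-2^-pred x zero    _   p∣ = subst (λ y → 2^ _ ∣ y - + 1) (sym (^-identityʳ x)) p∣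
  ∣-pow-2^-pred {e} x (suc s) 1≤e p∣ = subst (λ y → 2^ _ ∣ y - + 1) (sym (^-2^-suc x s))
    (∣-square-pred (x ^ (2 ℕ.^ s)) (ℕ.≤-trans 1≤e (ℕ.m≤n+m e s)) (∣-pow-2^-pred x s 1≤e p∣))

  ^-even : ∀ x s w → x ^ (2 ℕ.^ suc s ℕ.* w) ≡ ((x ^ 2) ^ (2 ℕ.^ s)) ^ w
  ^-even x s w = sym (trans (cong (_^ w) (^-*-assoc x 2 (2 ℕ.^ s))) (^-*-assoc x (2 ℕ.^ suc s) w))

  ∥-pow-even-pred : ∀ {e} x s j → 2 ≤ e → 2^ e ∥ x ^ 2 - + 1 →
    2^ (s ℕ.+ e) ∥ x ^ (2 ℕ.^ suc s ℕ.* (1 ℕ.+ 2 ℕ.* j)) - + 1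
  ∥-pow-even-pred {e} x s j 2≤e p∥ = subst (λ y → 2^ _ ∥ y - + 1) (sym (^-even x s (1 ℕ.+ 2 ℕ.* j)))
    (∥-pow-odd-pred ((x ^ 2) ^ (2 ℕ.^ s)) j (ℕ.≤-trans (s≤s z≤n) (ℕ.≤-trans 2≤e (ℕ.m≤n+m e s)))
      (∥-pow-2^-pred (x ^ 2) s 2≤e p∥))

  ∣-pow-even-pred : ∀ {e} x s w → 1 ≤ e → 2^ e ∣ x ^ 2 - + 1 → 2^ (s ℕ.+ e) ∣ x ^ (2 ℕ.^ suc s ℕ.* w) - + 1
  ∣-pow-even-pred {e} x s w 1≤e p∣ = subst (λ y → 2^ _ ∣ y - + 1) (sym (^-even x s w))
    (∣-pow-pred ((x ^ 2) ^ (2 ℕ.^ s)) w (∣-pow-2^-pred (x ^ 2) s 1≤e p∣))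

  odd-^ : ∀ {c} m → 2^ 0 ∥ c → 2^ 0 ∥ c ^ m
  odd-^ zero    _     = exactly (+ 0) refl
  odd-^ (suc m) c-odd = ∥-* c-odd (odd-^ m c-odd)

  odd-square-pred : ∀ {c} → 2^ 0 ∥ c → 2^ 3 ∣ c ^ 2 - + 1
  odd-square-pred (exactly k refl) with parity k
  ... | inj₁ (i , refl) = multiple (i * (+ 1 + + 2 * i)) (even-case i)
    where
    even-case : ∀ i → let c = + 1 * (+ 1 + + 2 * (+ 2 * i)) in
      c * (c * + 1) - + 1 ≡ i * (+ 1 + + 2 * i) * + 8
    even-case = solve-∀
  ... | inj₂ (exactly i refl) = multiple ((+ 1 + + 2 * i) * (+ 1 + i)) (odd-case i)
    where
    odd-case : ∀ i → let c = + 1 * (+ 1 + + 2 * (+ 1 * (+ 1 + + 2 * i))) in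
      c * (c * + 1) - + 1 ≡ (+ 1 + + 2 * i) * (+ 1 + i) * + 8
    odd-case = solve-∀

  3-odd : 2^ 0 ∥ + 3
  3-odd = exactly (+ 1) refl

  5-odd : 2^ 0 ∥ + 5
  5-odd = exactly (+ 2) refl

  7-odd : 2^ 0 ∥ + 7
  7-odd = exactly (+ 3) refl

  -- The odd bases i = 3, 5, 7 of 7! S(m,7) = Σᵢ (-1)^(7-i) C(7,i) i^m, each shifted to vanish at m = 0.
  oddPart₇ : ℕ → ℤ
  oddPart₇ t = (+ 7) ^ t - + 1 + + 21 * ((+ 5) ^ t - + 1) + + 35 * ((+ 3) ^ t - + 1)

  ∥-oddPart₇-* : ∀ {f g j} t m → 2^ f ∥ oddPart₇ t →
    2^ g ∣ (+ 7) ^ t - + 1 → 2^ g ∣ (+ 5) ^ t - + 1 → 2^ g ∣ (+ 3) ^ t - + 1 →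
    suc (j ℕ.+ f) ≤ g ℕ.+ g → 2^ j ∥ + m → 2^ (j ℕ.+ f) ∥ oddPart₇ (t ℕ.* m)
  ∥-oddPart₇-* {f} {g} {j} t m T∥ 7∣ 5∣ 3∣ bound m∥
    with pow-pred-expansion ((+ 7) ^ t) m | pow-pred-expansion ((+ 5) ^ t) m | pow-pred-expansion ((+ 3) ^ t) m
  ... | R₇ , eq₇ | R₅ , eq₅ | R₃ , eq₃ = subst (2^ (j ℕ.+ f) ∥_) (sym oddPart₇-eq)
    (∥-+-∣ (∥-* m∥ T∥) (∣-weaken bound
      (∣-+ (∣-+ (square R₇ 7∣) (∣-scale (+ 21) (square R₅ 5∣))) (∣-scale (+ 35) (square R₃ 3∣)))))
    where
    p : ℕ → ℤ
    p c = (+ c) ^ t - + 1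
    square : ∀ {x} R → 2^ g ∣ x → 2^ (g ℕ.+ g) ∣ R * x * x
    square R x∣ = ∣-* (∣-scale R x∣) x∣
    expand : ∀ c → (+ c) ^ (t ℕ.* m) - + 1 ≡ ((+ c) ^ t) ^ m - + 1
    expand c = cong (_- + 1) (sym (^-*-assoc (+ c) t m))
    oddPart₇-eq : oddPart₇ (t ℕ.* m)
                ≡ + m * oddPart₇ t + (R₇ * p 7 * p 7 + + 21 * (R₅ * p 5 * p 5) + + 35 * (R₃ * p 3 * p 3))
    oddPart₇-eq = begin
      oddPart₇ (t ℕ.* m)
        ≡⟨ cong₂ (λ a b → a + + 21 * b + + 35 * ((+ 3) ^ (t ℕ.* m) - + 1))
                 (trans (expand 7) eq₇) (trans (expand 5) eq₅) ⟩
      (+ m * p 7 + R₇ * p 7 * p 7) + + 21 * (+ m * p 5 + R₅ * p 5 * p 5) + + 35 * ((+ 3) ^ (t ℕ.* m) - + 1)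
        ≡⟨ cong (λ c → (+ m * p 7 + R₇ * p 7 * p 7) + + 21 * (+ m * p 5 + R₅ * p 5 * p 5) + + 35 * c)
                (trans (expand 3) eq₃) ⟩
      (+ m * p 7 + R₇ * p 7 * p 7) + + 21 * (+ m * p 5 + R₅ * p 5 * p 5) + + 35 * (+ m * p 3 + R₃ * p 3 * p 3)
        ≡⟨ regroup (+ m) (p 7) (p 5) (p 3) R₇ R₅ R₃ ⟩
      + m * oddPart₇ t + (R₇ * p 7 * p 7 + + 21 * (R₅ * p 5 * p 5) + + 35 * (R₃ * p 3 * p 3)) ∎
      where
      regroup : ∀ m a b c R₇ R₅ R₃ → (m * a + R₇ * a * a) + + 21 * (m * b + R₅ * b * b) + + 35 * (m * c + R₃ * c * c)
                                    ≡ m * (a + + 21 * b + + 35 * c) + (R₇ * a * a + + 21 * (R₅ * b * b) + + 35 * (R₃ * c * c))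
      regroup = solve-∀

  ∣-odd-pow-pred : ∀ {c} → 2^ 0 ∥ c → ∀ s w → 2^ (s ℕ.+ 3) ∣ c ^ (2 ℕ.^ suc s ℕ.* w) - + 1
  ∣-odd-pow-pred {c} c-odd s w = ∣-pow-even-pred c s w (s≤s z≤n) (odd-square-pred c-odd)

  ∣-odd-pow-2^-pred : ∀ {c} → 2^ 0 ∥ c → ∀ s → 2^ (s ℕ.+ 3) ∣ c ^ (2 ℕ.^ suc s) - + 1
  ∣-odd-pow-2^-pred {c} c-odd s =
    subst (λ m → 2^ (s ℕ.+ 3) ∣ c ^ m - + 1) (ℕ.*-identityʳ (2 ℕ.^ suc s)) (∣-odd-pow-pred c-odd s 1)

  ≤-of-+ : ∀ {a c} k → a ℕ.+ k ≡ c → a ≤ c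
  ≤-of-+ {a} k refl = ℕ.m≤m+n a k

  ∥-oddPart₇-2^ : ∀ s → 2 ≤ s → 2^ (s ℕ.+ 6) ∥ oddPart₇ (2 ℕ.^ suc s)
  ∥-oddPart₇-2^ (suc zero)          (s≤s ())
  ∥-oddPart₇-2^ (suc (suc zero))    _ = exactly (+ 27729) refl  -- oddPart₇ 8 = 2^8 · 55459
  ∥-oddPart₇-2^ (suc (suc (suc s))) _ = subst (λ t → 2^ (suc u ℕ.+ 6) ∥ oddPart₇ t) (ℕ.*-comm (2 ℕ.^ suc u) 2)
    (∥-oddPart₇-* (2 ℕ.^ suc u) 2 (∥-oddPart₇-2^ (suc (suc s)) (s≤s (s≤s z≤n)))
      (∣-odd-pow-2^-pred 7-odd u) (∣-odd-pow-2^-pred 5-odd u) (∣-odd-pow-2^-pred 3-odd u)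
      (≤-of-+ s (bound s)) (∥-pow2 1))
    where
    u : ℕ
    u = suc (suc s)
    bound : ∀ s → suc (1 ℕ.+ (suc (suc s) ℕ.+ 6)) ℕ.+ s ≡ (suc (suc s) ℕ.+ 3) ℕ.+ (suc (suc s) ℕ.+ 3)
    bound = ℕ-Solver.solve-∀

  ∥-oddPart₇ : ∀ s j → 2 ≤ s → 2^ (s ℕ.+ 6) ∥ oddPart₇ (2 ℕ.^ suc s ℕ.* (1 ℕ.+ 2 ℕ.* j))
  ∥-oddPart₇ (suc s) j 2≤s = ∥-oddPart₇-* (2 ℕ.^ suc (suc s)) (1 ℕ.+ 2 ℕ.* j) (∥-oddPart₇-2^ (suc s) 2≤s)
    (∣-odd-pow-2^-pred 7-odd (suc s)) (∣-odd-pow-2^-pred 5-odd (suc s)) (∣-odd-pow-2^-pred 3-odd (suc s))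
    (≤-of-+ s (bound s)) (1+2j-odd j)
    where
    bound : ∀ s → suc (suc s ℕ.+ 6) ℕ.+ s ≡ (suc s ℕ.+ 3) ℕ.+ (suc s ℕ.+ 3)
    bound = ℕ-Solver.solve-∀

module StirlingDifferences where

  open StirlingClosedForm
  open TwoAdicValuation
  open LiftingTheExponent
  open import Data.Integer using (ℤ; +_; -_; _+_; _-_; _*_; _^_)
  open import Data.Integer.Properties using (^-distribˡ-+-*; +-injective; i-j≡0⇒i≡j)
  open import Data.Integer.Tactic.RingSolver using (solve-∀)
  open import Function.Nary.NonDependent using (congₙ)
  open ≡-Reasoning

  stirling-3-difference : ∀ y t → 1 ≤ y →
    + 6 * Sdiff (y ℕ.+ t) y 3 ≡ (+ 3) ^ y * ((+ 3) ^ t - + 1) - + 3 * (+ 2) ^ y * ((+ 2) ^ t - + 1)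
  stirling-3-difference (suc y) t _ = begin
    + 6 * (+ S (suc y ℕ.+ t) 3 - + S (suc y) 3)
      ≡⟨ distrib (+ S (suc y ℕ.+ t) 3) (+ S (suc y) 3) ⟩
    + 6 * + S (suc (y ℕ.+ t)) 3 - + 6 * + S (suc y) 3
      ≡⟨ cong₂ _-_ (stirling-3 (y ℕ.+ t)) (stirling-3 y) ⟩
    ((+ 3) ^ (suc y ℕ.+ t) - + 3 * (+ 2) ^ (suc y ℕ.+ t) + + 3) - ((+ 3) ^ suc y - + 3 * (+ 2) ^ suc y + + 3)
      ≡⟨ cong₂ (λ u v → (u - + 3 * v + + 3) - ((+ 3) ^ suc y - + 3 * (+ 2) ^ suc y + + 3))
               (^-distribˡ-+-* (+ 3) (suc y) t) (^-distribˡ-+-* (+ 2) (suc y) t) ⟩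
    ((+ 3) ^ suc y * (+ 3) ^ t - + 3 * ((+ 2) ^ suc y * (+ 2) ^ t) + + 3) - ((+ 3) ^ suc y - + 3 * (+ 2) ^ suc y + + 3)
      ≡⟨ regroup ((+ 2) ^ suc y) ((+ 3) ^ suc y) ((+ 2) ^ t) ((+ 3) ^ t) ⟩
    (+ 3) ^ suc y * ((+ 3) ^ t - + 1) - + 3 * (+ 2) ^ suc y * ((+ 2) ^ t - + 1) ∎
    where
    distrib : ∀ a b → + 6 * (a - b) ≡ + 6 * a - + 6 * b
    distrib = solve-∀
    regroup : ∀ a b c d → (b * d - + 3 * (a * c) + + 3) - (b - + 3 * a + + 3) ≡ b * (d - + 1) - + 3 * a * (c - + 1)
    regroup = solve-∀

  crossPart₇ : ℕ → ℕ → ℤ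
  crossPart₇ y t = ((+ 7) ^ y - + 1) * ((+ 7) ^ t - + 1) + + 21 * (((+ 5) ^ y - + 1) * ((+ 5) ^ t - + 1))
         + + 35 * (((+ 3) ^ y - + 1) * ((+ 3) ^ t - + 1))

  -- Arranged so that -28 carries the valuation 2 and every other summand is visibly divisible by 8.
  evenPart₇ : ℕ → ℕ → ℤ
  evenPart₇ y t = - + 28 - + 7 * ((+ 3) ^ y - + 1) + (+ 7 * (+ 3) ^ y * (+ 3) ^ t + + 21) * (+ 2) ^ t
         + + 35 * ((+ 2) ^ t * (+ 2) ^ t - + 1) * (+ 2) ^ y

  stirling-7-difference : ∀ y t → 1 ≤ y →
    + 5040 * Sdiff (y ℕ.+ t) y 7 ≡ (oddPart₇ t + crossPart₇ y t) - (+ 2) ^ y * evenPart₇ y t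
  stirling-7-difference (suc y) t _ = begin
    + 5040 * (+ S (suc y ℕ.+ t) 7 - + S (suc y) 7)
      ≡⟨ distrib (+ S (suc y ℕ.+ t) 7) (+ S (suc y) 7) ⟩
    + 5040 * + S (suc (y ℕ.+ t)) 7 - + 5040 * + S (suc y) 7
      ≡⟨ cong₂ _-_ (stirling-7 (y ℕ.+ t)) (stirling-7 y) ⟩
    F₇-at (suc y ℕ.+ t) - F₇-at (suc y)
      ≡⟨ cong (_- F₇-at (suc y)) (congₙ 4 F₇ (split 2) (split 3) (split 5) (split 7)) ⟩
    F₇ (p 2 (suc y) * p 2 t) (p 3 (suc y) * p 3 t) (p 5 (suc y) * p 5 t) (p 7 (suc y) * p 7 t) - F₇-at (suc y)
      ≡⟨ decompose (p 2 (suc y)) (p 3 (suc y)) (p 5 (suc y)) (p 7 (suc y)) (p 2 t) (p 3 t) (p 5 t) (p 7 t) ⟩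
    (oddPart₇ t + crossPart₇ (suc y) t) - (+ 2) ^ suc y * evenPart₇ (suc y) t ∎
    where
    p : ℕ → ℕ → ℤ
    p c m = (+ c) ^ m
    F₇-at : ℕ → ℤ
    F₇-at m = F₇ (p 2 m) (p 3 m) (p 5 m) (p 7 m)
    split : ∀ c → p c (suc y ℕ.+ t) ≡ p c (suc y) * p c t
    split c = ^-distribˡ-+-* (+ c) (suc y) t
    distrib : ∀ a b → + 5040 * (a - b) ≡ + 5040 * a - + 5040 * b
    distrib = solve-∀
    decompose : ∀ a₂ a₃ a₅ a₇ b₂ b₃ b₅ b₇ →
      (a₇ * b₇ - + 7 * (a₂ * b₂ * (a₃ * b₃)) + + 21 * (a₅ * b₅) - + 35 * (a₂ * b₂ * (a₂ * b₂))
        + + 35 * (a₃ * b₃) - + 21 * (a₂ * b₂) + + 7)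
      - (a₇ - + 7 * (a₂ * a₃) + + 21 * a₅ - + 35 * (a₂ * a₂) + + 35 * a₃ - + 21 * a₂ + + 7)
      ≡ ((b₇ - + 1 + + 21 * (b₅ - + 1) + + 35 * (b₃ - + 1))
          + ((a₇ - + 1) * (b₇ - + 1) + + 21 * ((a₅ - + 1) * (b₅ - + 1)) + + 35 * ((a₃ - + 1) * (b₃ - + 1))))
        - a₂ * (- + 28 - + 7 * (a₃ - + 1) + (+ 7 * a₃ * b₃ + + 21) * b₂ + + 35 * (b₂ * b₂ - + 1) * a₂)
    decompose = solve-∀

  S-suc-1 : ∀ m → S (suc m) 1 ≡ 1
  S-suc-1 zero    = refl
  S-suc-1 (suc m) = cong (λ s → 1 ℕ.* s ℕ.+ 0) (S-suc-1 m)

  S-pos : ∀ m k → k ≤ m → 0 < S (suc m) (suc k)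
  S-pos m       zero    _         = ℕ.≤-reflexive (sym (S-suc-1 m))
  S-pos (suc m) (suc k) (s≤s k≤m) =
    ℕ.≤-trans (S-pos m k k≤m) (ℕ.m≤n+m (S (suc m) (suc k)) (suc (suc k) ℕ.* S (suc m) (suc (suc k))))

  S-<-suc : ∀ m k → suc k ≤ m → S m (suc (suc k)) < S (suc m) (suc (suc k))
  S-<-suc (suc m) k (s≤s k≤m) =
    ℕ.≤-trans (ℕ.m<m+n s (S-pos m k k≤m)) (ℕ.+-monoˡ-≤ (S (suc m) (suc k)) (ℕ.m≤m+n s (suc k ℕ.* s)))
    where
    s : ℕ
    s = S (suc m) (suc (suc k))

  S-strictly-increasing : ∀ {k y x} → 2 ≤ k → k ≤ y → y < x → S y k < S x k
  S-strictly-increasing {suc zero} (s≤s ())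
  S-strictly-increasing {suc (suc k)} {y} {suc x} _ k≤y (s≤s y≤x) with ℕ.m≤n⇒m<n∨m≡n y≤x
  ... | inj₂ refl = S-<-suc y k (ℕ.<⇒≤ k≤y)
  ... | inj₁ y<x  = ℕ.<-trans (S-strictly-increasing (s≤s (s≤s z≤n)) k≤y y<x)
                              (S-<-suc x k (ℕ.<⇒≤ (ℕ.<-≤-trans k≤y (ℕ.<⇒≤ y<x))))

  Sdiff≢0 : ∀ {k y x} → 2 ≤ k → k ≤ y → y < x → Sdiff x y k ≢ + 0
  Sdiff≢0 2≤k k≤y y<x eq = ℕ.<⇒≢ (S-strictly-increasing 2≤k k≤y y<x) (sym (+-injective (i-j≡0⇒i≡j _ _ eq)))

  pow2-pred-odd : ∀ t → 1 ≤ t → 2^ 0 ∥ (+ 2) ^ t - + 1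
  pow2-pred-odd (suc t) _ = exactly ((+ 2) ^ t - + 1) (shape ((+ 2) ^ t))
    where
    shape : ∀ p → + 2 * p - + 1 ≡ + 1 * (+ 1 + + 2 * (p - + 1))
    shape = solve-∀

  2^≤2^*odd : ∀ σ j → 2 ℕ.^ σ ≤ 2 ℕ.^ σ ℕ.* (1 ℕ.+ 2 ℕ.* j)
  2^≤2^*odd σ j = ℕ.m≤m*n (2 ℕ.^ σ) (1 ℕ.+ 2 ℕ.* j)

  stirling-3-min-valuation : ∀ {x y t} σ j e → x ≡ y ℕ.+ t → t ≡ 2 ℕ.^ σ ℕ.* (1 ℕ.+ 2 ℕ.* j) →
    1 ≤ σ → 3 ≤ y → 1 ℕ.+ e ≡ σ ℕ.+ 2 → MinValuation (Sdiff x y 3) e (y ℕ.∸ 1)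
  stirling-3-min-valuation {y = y} (suc s) j e refl refl _ 3≤y e-eq =
    ν₂-of-difference e (y ℕ.∸ 1) 3-odd (stirling-3-difference y t 1≤y) (Sdiff≢0 (s≤s (s≤s z≤n)) 3≤y (ℕ.m<m+n y 1≤t))
      (subst (2^_∥ (+ 3) ^ y * ((+ 3) ^ t - + 1)) (trans (ℕ.+-suc s 2) (sym e-eq))
        (∥-* (odd-^ y 3-odd) (∥-pow-even-pred (+ 3) s j (s≤s (s≤s z≤n)) (exactly (+ 0) refl))))
      (subst (2^_∥ + 3 * (+ 2) ^ y * ((+ 2) ^ t - + 1)) (trans (ℕ.+-identityʳ y) (sym (ℕ.m+[n∸m]≡n 1≤y)))
        (∥-* (∥-* 3-odd (∥-pow2 y)) (pow2-pred-odd t 1≤t)))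
    where
    t : ℕ
    t = 2 ℕ.^ suc s ℕ.* (1 ℕ.+ 2 ℕ.* j)
    1≤y : 1 ≤ y
    1≤y = ℕ.≤-trans (s≤s z≤n) 3≤y
    1≤t : 1 ≤ t
    1≤t = ℕ.≤-trans (ℕ.m^n>0 2 (suc s)) (2^≤2^*odd (suc s) j)

  ∣-crossPart₇ : ∀ r b s j → 1 ≤ r →
    2^ suc (s ℕ.+ 6) ∣ crossPart₇ (2 ℕ.^ suc r ℕ.* b) (2 ℕ.^ suc s ℕ.* (1 ℕ.+ 2 ℕ.* j))
  ∣-crossPart₇ (suc r) b s j _ =
    ∣-weaken (≤-of-+ r (bound r s)) (∣-+ (∣-+ (cross 7-odd) (∣-scale (+ 21) (cross 5-odd))) (∣-scale (+ 35) (cross 3-odd)))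
    where
    cross : ∀ {c} → 2^ 0 ∥ c →
      2^ ((suc r ℕ.+ 3) ℕ.+ (s ℕ.+ 3))
        ∣ (c ^ (2 ℕ.^ suc (suc r) ℕ.* b) - + 1) * (c ^ (2 ℕ.^ suc s ℕ.* (1 ℕ.+ 2 ℕ.* j)) - + 1)
    cross c-odd = ∣-* (∣-odd-pow-pred c-odd (suc r) b) (∣-odd-pow-pred c-odd s (1 ℕ.+ 2 ℕ.* j))
    bound : ∀ r s → suc (s ℕ.+ 6) ℕ.+ r ≡ (suc r ℕ.+ 3) ℕ.+ (s ℕ.+ 3)
    bound = ℕ-Solver.solve-∀

  ∥-evenPart₇ : ∀ r b t → 3 ≤ 2 ℕ.^ suc r ℕ.* b → 3 ≤ t → 2^ 2 ∥ evenPart₇ (2 ℕ.^ suc r ℕ.* b) t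
  ∥-evenPart₇ r b t 3≤y 3≤t =
    ∥-+-∣ (∥-+-∣ (∥-−-∣ (exactly (- + 4) refl)
                         (∣-scale (+ 7) (∣-weaken (ℕ.m≤n+m 3 r) (∣-odd-pow-pred 3-odd r b))))
                 (∣-weaken 3≤t (multiple (+ 7 * (+ 3) ^ y * (+ 3) ^ t + + 21) refl)))
          (∣-weaken 3≤y (multiple (+ 35 * ((+ 2) ^ t * (+ 2) ^ t - + 1)) refl))
    where
    y : ℕ
    y = 2 ℕ.^ suc r ℕ.* b

  stirling-7-min-valuation : ∀ {x y t} ρ b σ j e →
    x ≡ y ℕ.+ t → y ≡ 2 ℕ.^ ρ ℕ.* b → t ≡ 2 ℕ.^ σ ℕ.* (1 ℕ.+ 2 ℕ.* j) →
    2 ≤ ρ → 3 ≤ σ → 7 ≤ y → 4 ℕ.+ e ≡ σ ℕ.+ 5 → MinValuation (Sdiff x y 7) e (y ℕ.∸ 2)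
  stirling-7-min-valuation (suc r) b (suc s) j e refl refl refl (s≤s 1≤r) (s≤s 2≤s) 7≤y e-eq =
    ν₂-of-difference e (y ℕ.∸ 2) (exactly (+ 157) refl) (stirling-7-difference y t 1≤y)
      (Sdiff≢0 (s≤s (s≤s z≤n)) 7≤y (ℕ.m<m+n y 1≤t))
      (subst (2^_∥ oddPart₇ t + crossPart₇ y t) (trans (ℕ.+-suc s 5) (sym e-eq))
        (∥-+-∣ (∥-oddPart₇ s j 2≤s) (∣-crossPart₇ r b s j 1≤r)))
      (subst (2^_∥ (+ 2) ^ y * evenPart₇ y t) (sym f-eq) (∥-* (∥-pow2 y) (∥-evenPart₇ r b t 3≤y 3≤t)))
    where
    y t : ℕ
    y = 2 ℕ.^ suc r ℕ.* b
    t = 2 ℕ.^ suc s ℕ.* (1 ℕ.+ 2 ℕ.* j)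
    3≤y : 3 ≤ y
    3≤y = ℕ.≤-trans (s≤s (s≤s (s≤s z≤n))) 7≤y
    1≤y : 1 ≤ y
    1≤y = ℕ.≤-trans (s≤s z≤n) 3≤y
    f-eq : 4 ℕ.+ (y ℕ.∸ 2) ≡ y ℕ.+ 2
    f-eq = trans (cong (2 ℕ.+_) (ℕ.m+[n∸m]≡n (ℕ.≤-trans (s≤s (s≤s z≤n)) 3≤y))) (ℕ.+-comm 2 y)
    3≤t : 3 ≤ t
    3≤t = ℕ.≤-trans (ℕ.≤-trans (ℕ.m≤n+m 3 5) (ℕ.^-monoʳ-≤ 2 {3} (s≤s 2≤s))) (2^≤2^*odd (suc s) j)
    1≤t : 1 ≤ t
    1≤t = ℕ.≤-trans (s≤s z≤n) 3≤t

open TwoAdicValuation using (MinValuation)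
open StirlingDifferences using (stirling-3-min-valuation; stirling-7-min-valuation)
open import Data.Nat using (_+_; _*_; _^_; _∸_; _>_)

MinValuation⇒cases : ∀ {Δ e} k {M y} → e + k ≡ M → k ≤ y → MinValuation Δ e (y ∸ k) →
  (y > M → ν₂≡ Δ e) × (y ≡ M → ν₂> Δ e) × (y < M → ν₂≡ Δ (y ∸ k))
MinValuation⇒cases k {y = y} refl k≤y (e<f , e≡f , f<e) =
    (λ M<y → e<f (ℕ.+-cancelʳ-< k _ _ (subst (_ <_) (sym y∸k+k) M<y)))
  , (λ y≡M → e≡f (sym (ℕ.+-cancelʳ-≡ k _ _ (trans y∸k+k y≡M))))
  , (λ y<M → f<e (ℕ.+-cancelʳ-< k _ _ (subst (_< _) (sym y∸k+k) y<M)))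
  where
  y∸k+k : y ∸ k + k ≡ y
  y∸k+k = ℕ.m∸n+n≡m k≤y

ℕ-parity : ∀ q → (∃[ j ] q ≡ 2 * j) ⊎ (∃[ j ] q ≡ 1 + 2 * j)
ℕ-parity zero    = inj₁ (0 , refl)
ℕ-parity (suc q) with ℕ-parity q
... | inj₁ (j , refl) = inj₂ (j , refl)
... | inj₂ (j , refl) = inj₁ (suc j , double-suc j)
  where
  double-suc : ∀ j → suc (1 + 2 * j) ≡ 2 * suc j
  double-suc = ℕ-Solver.solve-∀

odd-cofactor : ∀ {m d} → ν₂≡ℕ m d → ∃[ j ] m ≡ (1 + 2 * j) * 2 ^ d
odd-cofactor {d = d} (_ , ℕ.divides q eq , not-higher) with ℕ-parity q
... | inj₂ (j , refl) = j , eq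
... | inj₁ (j , refl) = ⊥-elim (not-higher (ℕ.divides j (trans eq (regroup j (2 ^ d)))))
  where
  regroup : ∀ j p → 2 * j * p ≡ j * (2 * p)
  regroup = ℕ-Solver.solve-∀

*2^-split : ∀ {a b} n → b ≤ a → a * 2 ^ n ≡ b * 2 ^ n + (a ∸ b) * 2 ^ n
*2^-split {a} {b} n b≤a = trans (cong (_* 2 ^ n) (sym (ℕ.m+[n∸m]≡n b≤a))) (ℕ.*-distribʳ-+ (2 ^ n) b (a ∸ b))

*2^-cofactor : ∀ {m j d} n → m ≡ (1 + 2 * j) * 2 ^ d → m * 2 ^ n ≡ 2 ^ (n + d) * (1 + 2 * j)
*2^-cofactor {j = j} {d} n refl = trans (regroup (1 + 2 * j) (2 ^ d) (2 ^ n)) (cong (_* (1 + 2 * j)) (sym (ℕ.^-distribˡ-+-* 2 n d)))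
  where
  regroup : ∀ w p q → w * p * q ≡ q * p * w
  regroup = ℕ-Solver.solve-∀

2^≤*2^ : ∀ {b k} n → 1 ≤ b → k ≤ n → 2 ^ k ≤ b * 2 ^ n
2^≤*2^ {b} n 1≤b k≤n = ℕ.≤-trans (ℕ.^-monoʳ-≤ 2 k≤n) (ℕ.m≤n*m (2 ^ n) b {{ℕ.>-nonZero 1≤b}})

theorem1p2 : (a b n d : ℕ) → b < a → 1 ≤ b → ν₂≡ℕ (a ∸ b) d →
    (2 ≤ n →
      (b * 2 ^ n > n + 2 + d → ν₂≡ (Sdiff (a * 2 ^ n) (b * 2 ^ n) 3) (n + 1 + d))
      × (b * 2 ^ n ≡ n + 2 + d → ν₂> (Sdiff (a * 2 ^ n) (b * 2 ^ n) 3) (n + 1 + d))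
      × (b * 2 ^ n < n + 2 + d → ν₂≡ (Sdiff (a * 2 ^ n) (b * 2 ^ n) 3) (b * 2 ^ n ∸ 1)))
    × (3 ≤ n →
      (b * 2 ^ n > n + 3 + d → ν₂≡ (Sdiff (a * 2 ^ n) (b * 2 ^ n) 7) (n + 1 + d))
      × (b * 2 ^ n ≡ n + 3 + d → ν₂> (Sdiff (a * 2 ^ n) (b * 2 ^ n) 7) (n + 1 + d))
      × (b * 2 ^ n < n + 3 + d → ν₂≡ (Sdiff (a * 2 ^ n) (b * 2 ^ n) 7) (b * 2 ^ n ∸ 2)))
theorem1p2 a b n d b<a 1≤b ν₂[a-b]≡d with odd-cofactor {d = d} ν₂[a-b]≡d
... | j , a∸b≡ =
    (λ 2≤n → MinValuation⇒cases 1 (shift-3 n d) (ℕ.≤-trans (s≤s z≤n) (3≤y 2≤n))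
      (stirling-3-min-valuation (n + d) j (n + 1 + d) split cofactor
        (ℕ.≤-trans (ℕ.<⇒≤ 2≤n) (ℕ.m≤m+n n d)) (3≤y 2≤n) (lift-3 n d)))
  , (λ 3≤n → MinValuation⇒cases 2 (shift-7 n d) (ℕ.≤-trans (ℕ.m≤n+m 2 5) (7≤y 3≤n))
      (stirling-7-min-valuation n b (n + d) j (n + 1 + d) split (ℕ.*-comm b (2 ^ n)) cofactor
        (ℕ.<⇒≤ 3≤n) (ℕ.≤-trans 3≤n (ℕ.m≤m+n n d)) (7≤y 3≤n) (lift-7 n d)))
  where
  y : ℕ
  y = b * 2 ^ n
  split : a * 2 ^ n ≡ y + (a ∸ b) * 2 ^ n
  split = *2^-split n (ℕ.<⇒≤ b<a)
  cofactor : (a ∸ b) * 2 ^ n ≡ 2 ^ (n + d) * (1 + 2 * j)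
  cofactor = *2^-cofactor {j = j} {d} n a∸b≡
  3≤y : 2 ≤ n → 3 ≤ y
  3≤y 2≤n = ℕ.≤-trans (ℕ.n≤1+n 3) (2^≤*2^ n 1≤b 2≤n)
  7≤y : 3 ≤ n → 7 ≤ y
  7≤y 3≤n = ℕ.≤-trans (ℕ.n≤1+n 7) (2^≤*2^ n 1≤b 3≤n)
  shift-3 : ∀ n d → n + 1 + d + 1 ≡ n + 2 + d
  shift-3 = ℕ-Solver.solve-∀
  lift-3 : ∀ n d → 1 + (n + 1 + d) ≡ n + d + 2
  lift-3 = ℕ-Solver.solve-∀
  shift-7 : ∀ n d → n + 1 + d + 2 ≡ n + 3 + d
  shift-7 = ℕ-Solver.solve-∀
  lift-7 : ∀ n d → 4 + (n + 1 + d) ≡ n + d + 5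
  lift-7 = ℕ-Solver.solve-∀
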